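{- Let $(E,\rho)$ be a $2$-polymatroid with $2$-dual $\rho^*$. If $e\in E$ satisfies $\rho(\{e\})=2=\rho^*(\{e\})$, then $(\rho_{\downarrow e})^*=(\rho^*)_{\downarrow e}$, where on the left $^*$ denotes the $2$-dual of the $2$-polymatroid $\rho_{\downarrow e}$ on $E-e$.
   Context: A (integer) polymatroid is $(E,\rho)$ with $E$ finite, $\rho:2^E\to\mathbb{Z}$ normalized, nondecreasing and submodular; a $2$-polymatroid has $\rho(\{e\})\le 2$ for all $e$. The $2$-dual is $(E,\rho^*)$ with $\rho^*(X)=2|X|-\rho(E)+\rho(E-X)$. Compression: for $\rho(e)>0$, $\rho_{\downarrow e}$ is the polymatroid on $E-e$ with $\rho_{\downarrow e}(X)=\rho(X)-1$ if $\rho(X\cup e)=\rho(X)$ and $\rho_{\downarrow e}(X)=\rho(X)$ otherwise. -}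

module Defs where

open import Data.Nat using (ℕ; suc)
open import Data.Integer using (ℤ; +_; _+_; _-_; _≤_; 0ℤ; 1ℤ; _≟_)
open import Data.Fin using (Fin)
open import Data.Fin.Subset using (Subset; ⊥; ⊤; ⁅_⁆; _⊆_; _∪_; _∩_; ∁; ∣_∣; outside)
open import Data.Vec using (insertAt)
open import Data.Product using (_×_)
open import Relation.Binary.PropositionalEquality using (_≡_)
open import Relation.Nullary using (yes; no)

record IsPolymatroid {n : ℕ} (ρ : Subset n → ℤ) : Set where
  field
    normalized : ρ ⊥ ≡ 0ℤ
    nondecreasing : ∀ X Y → X ⊆ Y → ρ X ≤ ρ Y
    submodular : ∀ X Y → ρ (X ∪ Y) + ρ (X ∩ Y) ≤ ρ X + ρ Y

Is2Polymatroid : {n : ℕ} → (Subset n → ℤ) → Set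
Is2Polymatroid {n} ρ = IsPolymatroid ρ × (∀ (e : Fin n) → ρ ⁅ e ⁆ ≤ + 2)

dual2 : {n : ℕ} → (Subset n → ℤ) → Subset n → ℤ
dual2 ρ X = (+ (2 Data.Nat.* ∣ X ∣) - ρ ⊤) + ρ (∁ X)

-- E - e is identified with Fin n; a subset X of E - e is viewed as the
-- subset of E = Fin (suc n) obtained by inserting 'outside' at position e.
embed : {n : ℕ} → Fin (suc n) → Subset n → Subset (suc n)
embed e X = insertAt X e outside

compress : {n : ℕ} → (Subset (suc n) → ℤ) → Fin (suc n) → Subset n → ℤ
compress ρ e X with ρ (embed e X ∪ ⁅ e ⁆) ≟ ρ (embed e X)
... | yes _ = ρ (embed e X) - 1ℤ
... | no _ = ρ (embed e X)

-- Put A = (E − e) − X, a = ρ(A) and δ = ρ(A ∪ e) − a; by submodularity and ρ(e) = 2,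
-- δ ∈ {0, 1, 2}. The hypothesis ρ*(e) = 2 says ρ(E − e) = ρ(E), so compression lowers
-- the total rank by one and (ρ↓e)*(X) = 2|X| − ρ(E) + 1 + a − [δ = 0]. Complementation
-- turns the increment δ of ρ at A into the increment 2 − δ of ρ* at X, so
-- (ρ*)↓e(X) = 2|X| − ρ(E) + a + δ − [δ = 2]. The two agree since 1 − [δ = 0] = δ − [δ = 2]
-- for δ ∈ {0, 1, 2}.
module Submission where

open import Defs
open import Data.Bool using (_∨_; _∧_; not)
open import Data.Empty using (⊥-elim)
open import Data.Fin using (Fin; zero; suc)
open import Data.Fin.Subset
  using (Subset; ⁅_⁆; ⊥; ⊤; _∪_; _∩_; ∁; ∣_∣; inside; outside)
open import Data.Fin.Subset.Properties using (∣⁅x⁆∣≡1; ∪-identityʳ; ∩-zeroʳ; p⊆p∪q)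
open import Data.Integer using (ℤ; +_; -[1+_]; _+_; _-_; -_; _≤_; +≤+; 0ℤ; 1ℤ; _≟_)
open import Data.Integer.Properties
  using (+-comm; +-identityʳ; +-monoˡ-≤; i≤j⇒0≤j-i; pos-+; +-0-abelianGroup)
open import Algebra.Properties.AbelianGroup +-0-abelianGroup using (identityʳ-unique; ∙-cancelˡ)
open import Data.Integer.Tactic.RingSolver using (solve-∀)
open import Data.Nat using (ℕ; suc; _*_; s≤s)
import Data.Nat.Properties as ℕ
open import Data.Product using (_×_; _,_; proj₁; proj₂)
open import Data.Vec using (Vec; _∷_; insertAt; replicate; zipWith)
open import Data.Vec.Properties using (map-insertAt; map-replicate)
open import Relation.Binary.PropositionalEquality
  using (_≡_; _≢_; refl; sym; trans; cong; cong₂; subst; subst₂; module ≡-Reasoning)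
open import Relation.Nullary using (yes; no)

private
  variable
    A B C : Set
    n : ℕ

zipWith-insertAt : ∀ (f : A → B → C) (xs : Vec A n) (ys : Vec B n) (i : Fin (suc n)) x y →
                   zipWith f (insertAt xs i x) (insertAt ys i y) ≡ insertAt (zipWith f xs ys) i (f x y)
zipWith-insertAt f xs        ys        zero    x y = refl
zipWith-insertAt f (x′ ∷ xs) (y′ ∷ ys) (suc i) x y = cong (f x′ y′ ∷_) (zipWith-insertAt f xs ys i x y)

replicate-insertAt : ∀ (x : A) (i : Fin (suc n)) → replicate (suc n) x ≡ insertAt (replicate n x) i x
replicate-insertAt             x zero    = refl
replicate-insertAt {n = suc n} x (suc i) = cong (x ∷_) (replicate-insertAt x i)

⁅⁆-insertAt : (i : Fin (suc n)) → ⁅ i ⁆ ≡ insertAt ⊥ i inside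
⁅⁆-insertAt         zero    = refl
⁅⁆-insertAt {suc n} (suc i) = cong (outside ∷_) (⁅⁆-insertAt i)

∣insertAt-outside∣ : (p : Subset n) (i : Fin (suc n)) → ∣ insertAt p i outside ∣ ≡ ∣ p ∣
∣insertAt-outside∣ p             zero    = refl
∣insertAt-outside∣ (inside  ∷ p) (suc i) = cong suc (∣insertAt-outside∣ p i)
∣insertAt-outside∣ (outside ∷ p) (suc i) = ∣insertAt-outside∣ p i

∣insertAt-inside∣ : (p : Subset n) (i : Fin (suc n)) → ∣ insertAt p i inside ∣ ≡ suc ∣ p ∣
∣insertAt-inside∣ p             zero    = refl
∣insertAt-inside∣ (inside  ∷ p) (suc i) = cong suc (∣insertAt-inside∣ p i)
∣insertAt-inside∣ (outside ∷ p) (suc i) = ∣insertAt-inside∣ p i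

module _ (e : Fin (suc n)) where

  embed-∪-⁅⁆ : (X : Subset n) → embed e X ∪ ⁅ e ⁆ ≡ insertAt X e inside
  embed-∪-⁅⁆ X = begin
    embed e X ∪ ⁅ e ⁆                          ≡⟨ cong (embed e X ∪_) (⁅⁆-insertAt e) ⟩
    insertAt X e outside ∪ insertAt ⊥ e inside ≡⟨ zipWith-insertAt _∨_ X ⊥ e outside inside ⟩
    insertAt (X ∪ ⊥) e inside                  ≡⟨ cong (λ Y → insertAt Y e inside) (∪-identityʳ X) ⟩
    insertAt X e inside                        ∎
    where open ≡-Reasoning

  embed-∩-⁅⁆ : (X : Subset n) → embed e X ∩ ⁅ e ⁆ ≡ ⊥
  embed-∩-⁅⁆ X = begin
    embed e X ∩ ⁅ e ⁆                          ≡⟨ cong (embed e X ∩_) (⁅⁆-insertAt e) ⟩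
    insertAt X e outside ∩ insertAt ⊥ e inside ≡⟨ zipWith-insertAt _∧_ X ⊥ e outside inside ⟩
    insertAt (X ∩ ⊥) e outside                 ≡⟨ cong (λ Y → insertAt Y e outside) (∩-zeroʳ X) ⟩
    insertAt ⊥ e outside                       ≡⟨ sym (replicate-insertAt outside e) ⟩
    ⊥                                          ∎
    where open ≡-Reasoning

  embed-⊤-∪-⁅⁆ : embed e ⊤ ∪ ⁅ e ⁆ ≡ ⊤
  embed-⊤-∪-⁅⁆ = trans (embed-∪-⁅⁆ ⊤) (sym (replicate-insertAt inside e))

  ∁-embed : (X : Subset n) → ∁ (embed e X) ≡ embed e (∁ X) ∪ ⁅ e ⁆
  ∁-embed X = trans (map-insertAt not outside X e) (sym (embed-∪-⁅⁆ (∁ X)))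

  ∁-embed-∪-⁅⁆ : (X : Subset n) → ∁ (embed e X ∪ ⁅ e ⁆) ≡ embed e (∁ X)
  ∁-embed-∪-⁅⁆ X = trans (cong ∁ (embed-∪-⁅⁆ X)) (map-insertAt not inside X e)

  ∁-⁅⁆ : ∁ ⁅ e ⁆ ≡ embed e ⊤
  ∁-⁅⁆ = begin
    ∁ ⁅ e ⁆                   ≡⟨ cong ∁ (⁅⁆-insertAt e) ⟩
    ∁ (insertAt ⊥ e inside)   ≡⟨ map-insertAt not inside ⊥ e ⟩
    insertAt (∁ ⊥) e outside  ≡⟨ cong (λ Y → insertAt Y e outside) (map-replicate not outside n) ⟩
    embed e ⊤                 ∎
    where open ≡-Reasoning

  module _ (ρ : Subset (suc n) → ℤ) where

    dual2-⁅⁆ : dual2 ρ ⁅ e ⁆ ≡ (+ 2 - ρ ⊤) + ρ (embed e ⊤)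
    dual2-⁅⁆ = cong₂ (λ k Y → (+ (2 * k) - ρ ⊤) + ρ Y) (∣⁅x⁆∣≡1 e) ∁-⁅⁆

    dual2-embed : (X : Subset n) →
                  dual2 ρ (embed e X) ≡ (+ (2 * ∣ X ∣) - ρ ⊤) + ρ (embed e (∁ X) ∪ ⁅ e ⁆)
    dual2-embed X = cong₂ (λ k Y → (+ (2 * k) - ρ ⊤) + ρ Y) (∣insertAt-outside∣ X e) (∁-embed X)

    dual2-embed-∪-⁅⁆ : (X : Subset n) →
                       dual2 ρ (embed e X ∪ ⁅ e ⁆) ≡ (+ (2 * ∣ X ∣) + + 2 - ρ ⊤) + ρ (embed e (∁ X))
    dual2-embed-∪-⁅⁆ X = cong₂ (λ k Y → (k - ρ ⊤) + ρ Y) size (∁-embed-∪-⁅⁆ X)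
      where
      size : + (2 * ∣ embed e X ∪ ⁅ e ⁆ ∣) ≡ + (2 * ∣ X ∣) + + 2
      size = begin
        + (2 * ∣ embed e X ∪ ⁅ e ⁆ ∣) ≡⟨ cong (λ p → + (2 * ∣ p ∣)) (embed-∪-⁅⁆ X) ⟩
        + (2 * ∣ insertAt X e inside ∣) ≡⟨ cong (λ k → + (2 * k)) (∣insertAt-inside∣ X e) ⟩
        + (2 * suc ∣ X ∣)             ≡⟨ trans (cong +_ (ℕ.*-suc 2 ∣ X ∣)) (pos-+ 2 (2 * ∣ X ∣)) ⟩
        + 2 + + (2 * ∣ X ∣)           ≡⟨ +-comm (+ 2) (+ (2 * ∣ X ∣)) ⟩
        + (2 * ∣ X ∣) + + 2           ∎
        where open ≡-Reasoning

    dual2-increment : (X : Subset n) →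
                      dual2 ρ (embed e X ∪ ⁅ e ⁆) ≡
                      dual2 ρ (embed e X) + (+ 2 - (ρ (embed e (∁ X) ∪ ⁅ e ⁆) - ρ (embed e (∁ X))))
    dual2-increment X = begin
      dual2 ρ (embed e X ∪ ⁅ e ⁆)     ≡⟨ dual2-embed-∪-⁅⁆ X ⟩
      (s + + 2 - ρ ⊤) + a             ≡⟨ complementary s (ρ ⊤) a b ⟩
      ((s - ρ ⊤) + b) + (+ 2 - (b - a)) ≡⟨ cong (_+ (+ 2 - (b - a))) (sym (dual2-embed X)) ⟩
      dual2 ρ (embed e X) + (+ 2 - (b - a)) ∎
      where
      open ≡-Reasoning
      s a b : ℤ
      s = + (2 * ∣ X ∣)
      a = ρ (embed e (∁ X))
      b = ρ (embed e (∁ X) ∪ ⁅ e ⁆)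
      complementary : ∀ x t y z → (x + + 2 - t) + y ≡ ((x - t) + z) + (+ 2 - (z - y))
      complementary = solve-∀

module _ {ρ : Subset n → ℤ} (poly : IsPolymatroid ρ) where
  open IsPolymatroid poly

  increment-bounds : ∀ X Y → X ∩ Y ≡ ⊥ → 0ℤ ≤ ρ (X ∪ Y) - ρ X × ρ (X ∪ Y) - ρ X ≤ ρ Y
  increment-bounds X Y X∩Y≡⊥ =
    i≤j⇒0≤j-i (nondecreasing X (X ∪ Y) (p⊆p∪q Y)) ,
    subst₂ _≤_ (lhs (ρ (X ∪ Y)) (ρ X)) (rhs (ρ X) (ρ Y)) (+-monoˡ-≤ (- ρ X) subadditive)
    where
    subadditive : ρ (X ∪ Y) ≤ ρ X + ρ Y
    subadditive = subst (_≤ ρ X + ρ Y)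
      (trans (cong (λ Z → ρ (X ∪ Y) + ρ Z) X∩Y≡⊥) (trans (cong (λ z → ρ (X ∪ Y) + z) normalized) (+-identityʳ _)))
      (submodular X Y)
    lhs : ∀ u a → u + - a ≡ u - a
    lhs = solve-∀
    rhs : ∀ a y → a + y + - a ≡ y
    rhs = solve-∀

𝟙[_≡0] : ℤ → ℤ
𝟙[ + 0       ≡0] = 1ℤ
𝟙[ + suc _   ≡0] = 0ℤ
𝟙[ -[1+ _ ]  ≡0] = 0ℤ

𝟙[≢0] : ∀ {k} → k ≢ 0ℤ → 𝟙[ k ≡0] ≡ 0ℤ
𝟙[≢0] {+ 0}      k≢0 = ⊥-elim (k≢0 refl)
𝟙[≢0] {+ suc _}  _   = refl
𝟙[≢0] { -[1+ _ ]} _  = refl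

𝟙-balance : ∀ {k} → 0ℤ ≤ k → k ≤ + 2 → 1ℤ - 𝟙[ k ≡0] ≡ k - 𝟙[ + 2 - k ≡0]
𝟙-balance {+ 0} _ _ = refl
𝟙-balance {+ 1} _ _ = refl
𝟙-balance {+ 2} _ _ = refl
𝟙-balance {+ suc (suc (suc _))} _ (+≤+ (s≤s (s≤s ())))
𝟙-balance { -[1+ _ ]} () _

compress-increment : ∀ (ρ : Subset (suc n) → ℤ) e X k → ρ (embed e X ∪ ⁅ e ⁆) ≡ ρ (embed e X) + k →
                     compress ρ e X ≡ ρ (embed e X) - 𝟙[ k ≡0]
compress-increment ρ e X k inc with ρ (embed e X ∪ ⁅ e ⁆) ≟ ρ (embed e X)
... | yes loop = cong (λ j → ρ (embed e X) - 𝟙[ j ≡0]) (sym (identityʳ-unique _ k (trans (sym inc) loop)))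
... | no ¬loop = sym (trans (cong (λ z → ρ (embed e X) - z) (𝟙[≢0] k≢0)) (+-identityʳ _))
  where
  k≢0 : k ≢ 0ℤ
  k≢0 k≡0 = ¬loop (trans inc (trans (cong (λ z → ρ (embed e X) + z) k≡0) (+-identityʳ _)))

compress-⊤ : ∀ (ρ : Subset (suc n) → ℤ) e → ρ (embed e ⊤) ≡ ρ ⊤ → compress ρ e ⊤ ≡ ρ ⊤ - 1ℤ
compress-⊤ ρ e ρE-e≡ρE = trans
  (compress-increment ρ e ⊤ 0ℤ (trans (cong ρ (embed-⊤-∪-⁅⁆ e)) (trans (sym ρE-e≡ρE) (sym (+-identityʳ _)))))
  (cong (_- 1ℤ) ρE-e≡ρE)

dual2-⁅⁆≡2⇒ρ-embed-⊤≡ρ-⊤ : ∀ (ρ : Subset (suc n) → ℤ) e → dual2 ρ ⁅ e ⁆ ≡ + 2 → ρ (embed e ⊤) ≡ ρ ⊤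
dual2-⁅⁆≡2⇒ρ-embed-⊤≡ρ-⊤ ρ e ρ*e≡2 =
  ∙-cancelˡ (+ 2 - ρ ⊤) _ _ (trans (sym (dual2-⁅⁆ e ρ)) (trans ρ*e≡2 (sym (minus-plus (ρ ⊤)))))
  where
  minus-plus : ∀ t → (+ 2 - t) + t ≡ + 2
  minus-plus = solve-∀

compressions-agree : ∀ s t a b i j → 1ℤ - i ≡ (b - a) - j → (s - (t - 1ℤ)) + (a - i) ≡ ((s - t) + b) - j
compressions-agree s t a b i j balance = begin
  (s - (t - 1ℤ)) + (a - i)     ≡⟨ lhs s t a i ⟩
  ((s - t) + a) + (1ℤ - i)     ≡⟨ cong (λ d → ((s - t) + a) + d) balance ⟩
  ((s - t) + a) + ((b - a) - j) ≡⟨ rhs s t a b j ⟩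
  ((s - t) + b) - j            ∎
  where
  open ≡-Reasoning
  lhs : ∀ s t a i → (s - (t - 1ℤ)) + (a - i) ≡ ((s - t) + a) + (1ℤ - i)
  lhs = solve-∀
  rhs : ∀ s t a b j → ((s - t) + a) + ((b - a) - j) ≡ ((s - t) + b) - j
  rhs = solve-∀

lemma5p3 : (n : ℕ) (ρ : Subset (suc n) → ℤ) → Is2Polymatroid ρ →
    (e : Fin (suc n)) → ρ ⁅ e ⁆ ≡ + 2 → dual2 ρ ⁅ e ⁆ ≡ + 2 →
    ∀ (X : Subset n) → dual2 (compress ρ e) X ≡ compress (dual2 ρ) e X
lemma5p3 n ρ (poly , _) e ρe≡2 ρ*e≡2 X = begin
  dual2 (compress ρ e) X
    ≡⟨ cong (λ t → (s - t) + compress ρ e (∁ X)) (compress-⊤ ρ e (dual2-⁅⁆≡2⇒ρ-embed-⊤≡ρ-⊤ ρ e ρ*e≡2)) ⟩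
  (s - (ρ ⊤ - 1ℤ)) + compress ρ e (∁ X)
    ≡⟨ cong (λ c → (s - (ρ ⊤ - 1ℤ)) + c) (compress-increment ρ e (∁ X) δ (a+[b-a] a b)) ⟩
  (s - (ρ ⊤ - 1ℤ)) + (a - 𝟙[ δ ≡0])
    ≡⟨ compressions-agree s (ρ ⊤) a b _ _ (𝟙-balance 0≤δ δ≤2) ⟩
  ((s - ρ ⊤) + b) - 𝟙[ + 2 - δ ≡0]
    ≡⟨ cong (_- 𝟙[ + 2 - δ ≡0]) (sym (dual2-embed e ρ X)) ⟩
  dual2 ρ (embed e X) - 𝟙[ + 2 - δ ≡0]
    ≡⟨ sym (compress-increment (dual2 ρ) e X (+ 2 - δ) (dual2-increment e ρ X)) ⟩
  compress (dual2 ρ) e X ∎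
  where
  open ≡-Reasoning
  s a b δ : ℤ
  s = + (2 * ∣ X ∣)
  a = ρ (embed e (∁ X))
  b = ρ (embed e (∁ X) ∪ ⁅ e ⁆)
  δ = b - a

  a+[b-a] : ∀ x y → y ≡ x + (y - x)
  a+[b-a] = solve-∀

  bounds : 0ℤ ≤ δ × δ ≤ ρ ⁅ e ⁆
  bounds = increment-bounds poly (embed e (∁ X)) ⁅ e ⁆ (embed-∩-⁅⁆ e (∁ X))

  0≤δ : 0ℤ ≤ δ
  0≤δ = proj₁ bounds

  δ≤2 : δ ≤ + 2
  δ≤2 = subst (δ ≤_) ρe≡2 (proj₂ bounds)
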